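{- Let $b\ge 2$ be an integer and let $k,r,x,y$ be nonnegative integers with $2x\leq 2y<r<k-1$. Then $\gamma(k,r,x)+1\in I(k,r,y)$ and $s_b(\gamma(k,r,x)+1)=V(k,r,x)$.
   Context: Fix an integer $b\ge 2$. A base $b$ over-expansion of a positive integer $N$ is a word $d_kd_{k-1}\cdots d_0$ over $\{0,1,\ldots,b\}$ with $d_k\neq 0$ and $\sum_{i=0}^k d_ib^i=N$; the ordinary base $b$ expansion is the unique one using only digits $0,\dots,b-1$. For $n\ge 2$, $s_b(n)$ is the number of base $b$ over-expansions of $n-1$; $s_b(0)=0$, $s_b(1)=1$. $I(k,r,y)=\{n\in\mathbb N: b^k<n\le b^k+\sum_{i=0}^y b^{r-2i}\}$. For nonnegative integers $k,r,x$ with $2x<r<k-1$, $w(k,r,x)$ is the word $10^{k-r-1}(10)^x0(10)^{\lfloor r/2\rfloor-x}0$ if $r$ is odd and $10^{k-r-1}(10)^x0(10)^{\lfloor r/2\rfloor-x}$ if $r$ is even (exponents denote repetition), and $\gamma(k,r,x)$ is the positive integer whose ordinary base $b$ expansion is $w(k,r,x)$. $V(k,r,x)=\frac15\big((k-r)(2L_{r+2}-L_{r-4x+1})+2L_{r+1}+L_{r-4x+2}\big)$, where $L_j$ are the Lucas numbers with $L_1=1$, $L_2=3$, $L_{j+2}=L_{j+1}+L_j$ for all integers $j$. -}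

module Defs where

open import Data.Nat using (ℕ; zero; suc; _+_; _*_; _∸_; _^_; _≤_; _<_; _≤?_; _≟_; _/_)
open import Data.Nat using (_%_)
import Data.Empty
import Data.Product
open import Relation.Binary.PropositionalEquality using (_≡_)
import Data.Bool
open import Data.Bool using (Bool; true; false; if_then_else_)
open import Data.List using (List; []; _∷_; _++_; replicate; concat; map; concatMap; filter; length; foldl; foldr; upTo; all)
open import Data.List.Relation.Unary.All using (All)
open import Data.Product using (_×_; _,_; proj₁; proj₂)
open import Data.Integer as ℤ using (ℤ; +_; -[1+_])
open import Relation.Nullary using (¬_)
open import Relation.Nullary.Decidable using (⌊_⌋; ¬?; _×-dec_)
open import Relation.Unary using (Decidable)

value : ℕ → List ℕ → ℕ
value b = foldl (λ acc d → acc * b + d) 0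

words : ℕ → ℕ → List (List ℕ)
words b zero    = [] ∷ []
words b (suc ℓ) = concatMap (λ d → map (d ∷_) (words b ℓ)) (upTo (suc b))

IsOverExpansion : ℕ → ℕ → List ℕ → Set
IsOverExpansion b N []      = Data.Empty.⊥
IsOverExpansion b N (d ∷ w) = (¬ d ≡ 0) × (All (_≤ b) (d ∷ w)) × (value b (d ∷ w) ≡ N)

-- decision used for counting (digits are already ≤ b in `words`)
private
  goodWord : ℕ → ℕ → List ℕ → Bool
  goodWord b N []      = false
  goodWord b N (d ∷ w) = ⌊ ¬? (d ≟ 0) ⌋ Data.Bool.∧ ⌊ value b (d ∷ w) ≟ N ⌋
  
-- A word with nonzero leading
-- digit and value N has length k+1 with 2^k ≤ b^k ≤ N, hence length ≤ N, so
-- enumerating all words of lengths 1..N over {0..b} is exhaustive.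
numOverExpansions : ℕ → ℕ → ℕ
numOverExpansions b N =
  length (filter (λ w → goodWord b N w Data.Bool.≟ true)
                 (concatMap (λ ℓ → words b (suc ℓ)) (upTo N)))

s : ℕ → ℕ → ℕ
s b zero          = 0
s b (suc zero)    = 1
s b (suc (suc m)) = numOverExpansions b (suc m)

sumPow : ℕ → ℕ → ℕ → ℕ
sumPow b r zero    = b ^ r
sumPow b r (suc y) = sumPow b r y + b ^ (r ∸ 2 * suc y)

InI : ℕ → ℕ → ℕ → ℕ → ℕ → Set
InI b k r y n = (b ^ k < n) × (n ≤ b ^ k + sumPow b r y)

w : ℕ → ℕ → ℕ → List ℕ
w k r x =
  1 ∷ replicate (k ∸ r ∸ 1) 0
  ++ concat (replicate x (1 ∷ 0 ∷ []))
  ++ 0 ∷ concat (replicate (r / 2 ∸ x) (1 ∷ 0 ∷ []))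
  ++ (if ⌊ r % 2 ≟ 1 ⌋ then 0 ∷ [] else [])

γ : ℕ → ℕ → ℕ → ℕ → ℕ
γ b k r x = value b (w k r x)

-- Lucas numbers on all integers: L₀ = 2, L₁ = 1, L_{j+2} = L_{j+1} + L_j
lucasPairℕ : ℕ → ℤ × ℤ          -- (L_n , L_{n+1})
lucasPairℕ zero    = + 2 , + 1
lucasPairℕ (suc n) =  proj₂ (lucasPairℕ n) , (proj₁ (lucasPairℕ n) ℤ.+ proj₂ (lucasPairℕ n))

lucasPairNeg : ℕ → ℤ × ℤ        -- (L_{-n} , L_{-n+1})
lucasPairNeg zero    = + 2 , + 1
lucasPairNeg (suc n) =  (proj₂ (lucasPairNeg n) ℤ.- proj₁ (lucasPairNeg n)) , proj₁ (lucasPairNeg n)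

L : ℤ → ℤ
L (+ n)      = proj₁ (lucasPairℕ n)
L -[1+ n ]   = proj₁ (lucasPairNeg (suc n))

-- 5·V(k,r,x) = (k-r)(2L_{r+2} - L_{r-4x+1}) + 2L_{r+1} + L_{r-4x+2}   (as an integer)
fiveV : ℕ → ℕ → ℕ → ℤ
fiveV k r x =
  (+ k ℤ.- + r) ℤ.* (+ 2 ℤ.* L (+ r ℤ.+ + 2) ℤ.- L (+ r ℤ.- + (4 * x) ℤ.+ + 1))
  ℤ.+ + 2 ℤ.* L (+ r ℤ.+ + 1) ℤ.+ L (+ r ℤ.- + (4 * x) ℤ.+ + 2)

module Submission where

-- Read an over-expansion u of N and the ordinary expansion of N from the most significant
-- digit: every prefix of u is equal to, or one less than, the corresponding prefix of N
-- (a carry of 0 or 1 into the remaining digits). Hence over-expansions are counted by a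
-- product of 2×2 transfer matrices indexed by the digits of N (carryStep), and s_b(N+1) is
-- its no-carry entry. The digits of γ(k,r,x) are 1, then k-r-1 zeros, x blocks 10, a 0,
-- ⌊r/2⌋-x blocks 10 and a final 0 when r is odd. A block 10 acts by [[2,1],[1,1]], the
-- square of the Fibonacci matrix: after the trailing blocks the counts are consecutive
-- Fibonacci numbers, and from the middle 0 on they are combinations of Lucas numbers, one
-- index rising and one falling by 2 per block. The run of zeros contributes the factor
-- k-r, which gives V(k,r,x). Finally γ(k,r,x) - b^k is b^r + b^(r-2) + ... + b^(r-2x+2)
-- plus a number below b^(r-2x), which places γ(k,r,x) + 1 in I(k,r,x) ⊆ I(k,r,y).

open import Defs
open import Data.Nat using (ℕ; _+_; _*_; _≤_; _<_)
open import Data.Integer using (+_)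
open import Data.Product using (_×_)
open import Relation.Binary.PropositionalEquality using (_≡_)

open import Data.Bool as Bool using (Bool; true; false; if_then_else_)
open import Data.Integer as ℤ using (ℤ; -[1+_])
import Data.Integer.Properties as ℤP
import Data.Integer.Tactic.RingSolver as ℤSolver
open import Data.List using (List; []; _∷_; _++_; map; concat; concatMap; filter; length; applyUpTo; upTo; foldl; foldr; replicate)
open import Data.List.Properties using (map-upTo; foldr-++; length-++; length-replicate)
open import Data.List.Relation.Unary.All using (All; []; _∷_)
open import Data.List.Relation.Unary.All.Properties using (++⁺; concat⁺; replicate⁺)
open import Data.Nat using (zero; suc; _∸_; _^_; _/_; _%_; z≤n; s≤s; z<s; _≟_)
open import Data.Nat.DivMod using (m%n<n; m≡m%n+[m/n]*n; m*n/n≡m; /-monoˡ-≤)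
open import Data.Nat.ListAction using (sum)
open import Data.Nat.Properties
open import Data.Nat.Tactic.RingSolver using (solve-∀)
open import Data.Product using (_,_; proj₁; proj₂)
open import Data.Sum using (_⊎_; inj₁; inj₂)
open import Function using (_∘_)
open import Level using (0ℓ)
open import Relation.Binary.Definitions using (tri<; tri≈; tri>)
open import Relation.Binary.PropositionalEquality using (_≗_; _≢_; refl; sym; trans; cong; cong₂; subst; subst₂; module ≡-Reasoning)
open import Relation.Nullary using (Dec; does; yes; no; contradiction)
open import Relation.Nullary.Decidable using (⌊_⌋; dec-true; dec-false)
open import Relation.Unary using (Pred; Decidable)

private variable
  A B : Set

-- Counting with Boolean tests

indicator : Bool → ℕ
indicator true  = 1
indicator false = 0

count : (A → Bool) → List A → ℕ
count p []       = 0
count p (x ∷ xs) = indicator (p x) + count p xs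

length-filter≡count : {P : Pred A 0ℓ} (P? : Decidable P) (p : A → Bool) →
                      (∀ x → does (P? x) ≡ p x) → ∀ xs → length (filter P? xs) ≡ count p xs
length-filter≡count P? p P?≗p []       = refl
length-filter≡count P? p P?≗p (x ∷ xs) with does (P? x) | p x | P?≗p x
... | true  | _ | refl = cong suc (length-filter≡count P? p P?≗p xs)
... | false | _ | refl = length-filter≡count P? p P?≗p xs

count-++ : (p : A → Bool) (xs ys : List A) → count p (xs ++ ys) ≡ count p xs + count p ys
count-++ p []       ys = refl
count-++ p (x ∷ xs) ys = trans (cong (_+_ (indicator (p x))) (count-++ p xs ys)) (sym (+-assoc (indicator (p x)) _ _))

count-map : (p : B → Bool) (f : A → B) (xs : List A) → count p (map f xs) ≡ count (p ∘ f) xs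
count-map p f []       = refl
count-map p f (x ∷ xs) = cong (_+_ (indicator (p (f x)))) (count-map p f xs)

count-none : (p : A → Bool) → (∀ x → p x ≡ false) → ∀ xs → count p xs ≡ 0
count-none p none []       = refl
count-none p none (x ∷ xs) = trans (cong (λ β → indicator β + count p xs) (none x)) (count-none p none xs)

count-concatMap : (p : B → Bool) (f : A → List B) (xs : List A) →
                  count p (concatMap f xs) ≡ sum (map (count p ∘ f) xs)
count-concatMap p f []       = refl
count-concatMap p f (x ∷ xs) =
  trans (count-++ p (f x) (concatMap f xs)) (cong (_+_ (count p (f x))) (count-concatMap p f xs))

count-concatMap-upTo : (p : B → Bool) (f : ℕ → List B) (n : ℕ) →
                       count p (concatMap f (upTo n)) ≡ sum (applyUpTo (count p ∘ f) n)
count-concatMap-upTo p f n = trans (count-concatMap p f (upTo n)) (cong sum (map-upTo (count p ∘ f) n))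

sum-applyUpTo-cong : {f g : ℕ → ℕ} → f ≗ g → ∀ n → sum (applyUpTo f n) ≡ sum (applyUpTo g n)
sum-applyUpTo-cong f≗g zero    = refl
sum-applyUpTo-cong f≗g (suc n) = cong₂ _+_ (f≗g 0) (sum-applyUpTo-cong (f≗g ∘ suc) n)

sum-applyUpTo-linear : (f g : ℕ → ℕ) (a b n : ℕ) →
  sum (applyUpTo (λ i → f i * a + g i * b) n) ≡ sum (applyUpTo f n) * a + sum (applyUpTo g n) * b
sum-applyUpTo-linear f g a b zero    = refl
sum-applyUpTo-linear f g a b (suc n) = begin
  f 0 * a + g 0 * b + sum (applyUpTo (λ i → f (suc i) * a + g (suc i) * b) n)
    ≡⟨ cong (_+_ (f 0 * a + g 0 * b)) (sum-applyUpTo-linear (f ∘ suc) (g ∘ suc) a b n) ⟩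
  f 0 * a + g 0 * b + (sum (applyUpTo (f ∘ suc) n) * a + sum (applyUpTo (g ∘ suc) n) * b)
    ≡⟨ regroup (f 0) (g 0) (sum (applyUpTo (f ∘ suc) n)) (sum (applyUpTo (g ∘ suc) n)) a b ⟩
  (f 0 + sum (applyUpTo (f ∘ suc) n)) * a + (g 0 + sum (applyUpTo (g ∘ suc) n)) * b ∎
  where
  open ≡-Reasoning
  regroup : ∀ u v s t a b → u * a + v * b + (s * a + t * b) ≡ (u + s) * a + (v + t) * b
  regroup = solve-∀

sum-applyUpTo-telescope : (c h : ℕ → ℕ) → (∀ i → c i + h i ≡ h (suc i)) → ∀ n → sum (applyUpTo c n) + h 0 ≡ h n
sum-applyUpTo-telescope c h step zero    = refl
sum-applyUpTo-telescope c h step (suc n) = begin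
  c 0 + sum (applyUpTo (c ∘ suc) n) + h 0   ≡⟨ +-assoc (c 0) _ (h 0) ⟩
  c 0 + (sum (applyUpTo (c ∘ suc) n) + h 0) ≡⟨ cong (_+_ (c 0)) (+-comm _ (h 0)) ⟩
  c 0 + (h 0 + sum (applyUpTo (c ∘ suc) n)) ≡⟨ sym (+-assoc (c 0) (h 0) _) ⟩
  c 0 + h 0 + sum (applyUpTo (c ∘ suc) n)   ≡⟨ cong (_+ sum (applyUpTo (c ∘ suc) n)) (step 0) ⟩
  h 1 + sum (applyUpTo (c ∘ suc) n)         ≡⟨ +-comm (h 1) _ ⟩
  sum (applyUpTo (c ∘ suc) n) + h 1         ≡⟨ sum-applyUpTo-telescope (c ∘ suc) (h ∘ suc) (step ∘ suc) n ⟩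
  h (suc n)                                 ∎
  where open ≡-Reasoning

-- Digit words

readFrom : ℕ → ℕ → List ℕ → ℕ
readFrom b = foldl (λ acc d → acc * b + d)

readFrom≡*^+value : ∀ b a u → readFrom b a u ≡ a * b ^ length u + value b u
readFrom≡*^+value b a []      = sym (trans (+-identityʳ (a * 1)) (*-identityʳ a))
readFrom≡*^+value b a (d ∷ u) = begin
  readFrom b (a * b + d) u                  ≡⟨ readFrom≡*^+value b (a * b + d) u ⟩
  (a * b + d) * b ^ length u + value b u    ≡⟨ regroup a b d (b ^ length u) (value b u) ⟩
  a * (b * b ^ length u) + (d * b ^ length u + value b u)
    ≡⟨ cong (_+_ (a * (b * b ^ length u))) (sym (readFrom≡*^+value b d u)) ⟩
  a * (b * b ^ length u) + value b (d ∷ u)  ∎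
  where
  open ≡-Reasoning
  regroup : ∀ a b d p v → (a * b + d) * p + v ≡ a * (b * p) + (d * p + v)
  regroup = solve-∀

value-∷ : ∀ b d u → value b (d ∷ u) ≡ d * b ^ length u + value b u
value-∷ b d u = readFrom≡*^+value b d u

value-zeros-++ : ∀ b t u → value b (replicate t 0 ++ u) ≡ value b u
value-zeros-++ b zero    u = refl
value-zeros-++ b (suc t) u = value-zeros-++ b t u

value-1∷zeros++ : ∀ b j u → value b (1 ∷ replicate j 0 ++ u) ≡ b ^ (j + length u) + value b u
value-1∷zeros++ b j u = trans (value-∷ b 1 (replicate j 0 ++ u))
  (cong₂ _+_ (trans (*-identityˡ _) (cong (b ^_) (trans (length-++ (replicate j 0)) (cong (_+ length u) (length-replicate j)))))
             (value-zeros-++ b j u))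

value<b^length : ∀ b {u} → All (_< b) u → value b u < b ^ length u
value<b^length b []                 = s≤s z≤n
value<b^length b {d ∷ u} (d<b ∷ u<b) = begin-strict
  value b (d ∷ u)                   ≡⟨ value-∷ b d u ⟩
  d * b ^ length u + value b u      <⟨ +-monoʳ-< (d * b ^ length u) (value<b^length b u<b) ⟩
  d * b ^ length u + b ^ length u   ≡⟨ +-comm (d * b ^ length u) _ ⟩
  suc d * b ^ length u              ≤⟨ *-monoˡ-≤ (b ^ length u) d<b ⟩
  b * b ^ length u                  ∎
  where open ≤-Reasoning

n<b^n : ∀ {b} → 2 ≤ b → ∀ n → n < b ^ n
n<b^n 2≤b zero    = s≤s z≤n
n<b^n {b} 2≤b (suc n) = begin-strict
  suc n               <⟨ +-monoʳ-< 1 (n<b^n 2≤b n) ⟩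
  1 + b ^ n           ≤⟨ +-monoˡ-≤ (b ^ n) (≤-trans (s≤s z≤n) (n<b^n 2≤b n)) ⟩
  b ^ n + b ^ n       ≡⟨ cong (_+_ (b ^ n)) (sym (+-identityʳ (b ^ n))) ⟩
  2 * b ^ n           ≤⟨ *-monoˡ-≤ (b ^ n) 2≤b ⟩
  b * b ^ n           ∎
  where open ≤-Reasoning

-- Over-expansions and carries

δ : ℕ → ℕ → ℕ
δ m n = indicator (does (m ≟ n))

δ-refl : ∀ m → δ m m ≡ 1
δ-refl m = cong indicator (dec-true (m ≟ m) refl)

δ-≢ : ∀ {m n} → m ≢ n → δ m n ≡ 0
δ-≢ {m} {n} m≢n = cong indicator (dec-false (m ≟ n) m≢n)

δ-window : ℕ → ℕ → ℕ → ℕ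
δ-window m zero    c = 0
δ-window m (suc K) c = δ m c + δ-window (suc m) K c

sum-δ≡δ-window : ∀ m K c → sum (applyUpTo (λ d → δ (m + d) c) K) ≡ δ-window m K c
sum-δ≡δ-window m zero    c = refl
sum-δ≡δ-window m (suc K) c = cong₂ _+_ (cong (λ t → δ t c) (+-identityʳ m))
  (trans (sum-applyUpTo-cong (λ d → cong (λ t → δ t c) (+-suc m d)) K) (sum-δ≡δ-window (suc m) K c))

δ-window-below : ∀ {m c} K → c < m → δ-window m K c ≡ 0
δ-window-below zero    c<m = refl
δ-window-below (suc K) c<m = cong₂ _+_ (δ-≢ (>⇒≢ c<m)) (δ-window-below K (m<n⇒m<1+n c<m))

δ-window-above : ∀ m K {c} → m + K ≤ c → δ-window m K c ≡ 0
δ-window-above m zero    m+K≤c = refl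
δ-window-above m (suc K) m+K≤c =
  cong₂ _+_ (δ-≢ (<⇒≢ (≤-trans (s≤s (m≤m+n m K)) (≤-trans (≤-reflexive (sym (+-suc m K))) m+K≤c))))
            (δ-window-above (suc m) K (≤-trans (≤-reflexive (sym (+-suc m K))) m+K≤c))

δ-window-inside : ∀ {m c} K → m ≤ c → c < m + K → δ-window m K c ≡ 1
δ-window-inside {m} zero    m≤c c<m+0 = contradiction (≤-trans c<m+0 (≤-reflexive (+-identityʳ m))) (≤⇒≯ m≤c)
δ-window-inside {m} {c} (suc K) m≤c c<m+K with m ≟ c
... | yes refl = cong₂ _+_ (δ-refl m) (δ-window-below K (n<1+n m))
... | no m≢c   = trans (cong (_+ δ-window (suc m) K c) (δ-≢ m≢c))
                        (δ-window-inside K (≤∧≢⇒< m≤c m≢c) (≤-trans c<m+K (≤-reflexive (+-suc m K))))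

m+1+b≡b+m+1 : ∀ b m → m + suc b ≡ b + m + 1
m+1+b≡b+m+1 = solve-∀

q<a⇒q*b+n<a*b : ∀ {a b n q} → n < b → q < a → q * b + n < a * b
q<a⇒q*b+n<a*b {a} {b} {n} {q} n<b q<a = begin-strict
  q * b + n   <⟨ +-monoʳ-< (q * b) n<b ⟩
  q * b + b   ≡⟨ +-comm (q * b) b ⟩
  suc q * b   ≤⟨ *-monoˡ-≤ b q<a ⟩
  a * b       ∎
  where open ≤-Reasoning

1+a<q⇒1+a*b+1+b≤q*b+n : ∀ {a b n q} → 2 ≤ b → suc a < q → suc (a * b) + suc b ≤ q * b + n
1+a<q⇒1+a*b+1+b≤q*b+n {a} {b} {n} {q} 2≤b 1+a<q = begin
  suc (a * b) + suc b   ≡⟨ +-suc (suc (a * b)) b ⟩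
  2 + (a * b + b)       ≤⟨ +-monoˡ-≤ (a * b + b) 2≤b ⟩
  b + (a * b + b)       ≡⟨ cong (_+_ b) (+-comm (a * b) b) ⟩
  suc (suc a) * b       ≤⟨ *-monoˡ-≤ b 1+a<q ⟩
  q * b                 ≤⟨ m≤m+n (q * b) n ⟩
  q * b + n             ∎
  where open ≤-Reasoning

infix 7 _·_
_·_ : ℕ × ℕ → ℕ × ℕ → ℕ
(i , j) · (x , y) = i * x + j * y

[1,0]·_ : ∀ X → (1 , 0) · X ≡ proj₁ X
[1,0]· (x , y) = trans (+-identityʳ (x + 0)) (+-identityʳ x)

[0,1]·_ : ∀ X → (0 , 1) · X ≡ proj₂ X
[0,1]· (x , y) = +-identityʳ y

[1,1]·_ : ∀ X → (1 , 1) · X ≡ proj₁ X + proj₂ X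
[1,1]· (x , y) = cong₂ _+_ (+-identityʳ x) (+-identityʳ y)

-- carryCounts ds = (n₀ , n₁): among the words over {0,…,b} of length |ds|, n₀ have the value
-- of ds and n₁ have that value plus b^|ds| (a carry into the preceding digit).
carryStep : ℕ → ℕ × ℕ → ℕ × ℕ
carryStep zero          (n₀ , n₁) = n₀ , n₀ + n₁
carryStep (suc zero)    (n₀ , n₁) = n₀ + n₁ , n₁
carryStep (suc (suc _)) (n₀ , n₁) = n₀ + n₁ , 0

carryCounts : List ℕ → ℕ × ℕ
carryCounts = foldr carryStep (1 , 0)

δ-windows : ℕ → ℕ → ℕ → ℕ × ℕ
δ-windows m K c = δ-window m K c , δ-window (suc m) K c

module _ (X : ℕ × ℕ) where

  δ-windows-no-carry : ∀ {b} m n → n < b → δ-windows m (suc b) (m + n) · X ≡ proj₁ (carryStep n X)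
  δ-windows-no-carry {b} m zero 0<b =
    trans (cong₂ (λ i j → (i , j) · X)
                 (δ-window-inside (suc b) (m≤m+n m 0) (+-monoʳ-< m z<s))
                 (δ-window-below (suc b) (s≤s (≤-reflexive (+-identityʳ m)))))
          ([1,0]· X)
  δ-windows-no-carry {b} m (suc n) 1+n<b =
    trans (cong₂ (λ i j → (i , j) · X)
                 (δ-window-inside (suc b) (m≤m+n m (suc n)) m+1+n<m+1+b)
                 (δ-window-inside (suc b) (≤-trans (s≤s (m≤m+n m n)) (≤-reflexive (sym (+-suc m n))))
                                          (m<n⇒m<1+n m+1+n<m+1+b)))
          (trans ([1,1]· X) (proj₁-carryStep-suc n))
    where
    m+1+n<m+1+b : m + suc n < m + suc b
    m+1+n<m+1+b = +-monoʳ-< m (m<n⇒m<1+n 1+n<b)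
    proj₁-carryStep-suc : ∀ n → proj₁ X + proj₂ X ≡ proj₁ (carryStep (suc n) X)
    proj₁-carryStep-suc zero    = refl
    proj₁-carryStep-suc (suc _) = refl

  δ-windows-carry : ∀ {b} m n → 1 ≤ b → n < b → δ-windows m (suc b) (b + m + n) · X ≡ proj₂ (carryStep n X)
  δ-windows-carry {b} m zero 1≤b _ =
    trans (cong₂ (λ i j → (i , j) · X)
                 (δ-window-inside (suc b) (≤-trans (m≤n+m m b) (m≤m+n (b + m) 0)) (≤-reflexive 1+b+m+0≡m+1+b))
                 (δ-window-inside (suc b) (≤-trans (+-monoˡ-≤ m 1≤b) (m≤m+n (b + m) 0))
                                          (m<n⇒m<1+n (≤-reflexive 1+b+m+0≡m+1+b))))
          ([1,1]· X)
    where
    1+b+m+0≡m+1+b : suc (b + m + 0) ≡ m + suc b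
    1+b+m+0≡m+1+b = trans (cong suc (+-identityʳ (b + m))) (trans (cong suc (+-comm b m)) (sym (+-suc m b)))
  δ-windows-carry {b} m (suc zero) 1≤b _ =
    trans (cong₂ (λ i j → (i , j) · X)
                 (δ-window-above m (suc b) (≤-reflexive (m+1+b≡b+m+1 b m)))
                 (δ-window-inside (suc b) (≤-trans (+-monoˡ-≤ m 1≤b) (m≤m+n (b + m) 1))
                                          (s≤s (≤-reflexive (sym (m+1+b≡b+m+1 b m))))))
          ([0,1]· X)
  δ-windows-carry {b} m (suc (suc n)) 1≤b _ =
    cong₂ (λ i j → (i , j) · X)
          (δ-window-above m (suc b) (≤-trans (≤-reflexive (m+1+b≡b+m+1 b m)) (+-monoʳ-≤ (b + m) (s≤s z≤n))))
          (δ-window-above (suc m) (suc b) (≤-trans (s≤s (≤-reflexive (m+1+b≡b+m+1 b m)))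
                                                   (≤-trans (≤-reflexive (sym (+-suc (b + m) 1)))
                                                            (+-monoʳ-≤ (b + m) (s≤s (s≤s z≤n))))))

  δ-windows-empty : ∀ m K {c} → c < m ⊎ suc m + K ≤ c → δ-windows m K c · X ≡ 0
  δ-windows-empty m K (inj₁ c<m) =
    cong₂ (λ i j → (i , j) · X) (δ-window-below K c<m) (δ-window-below K (m<n⇒m<1+n c<m))
  δ-windows-empty m K (inj₂ 1+m+K≤c) =
    cong₂ (λ i j → (i , j) · X) (δ-window-above m K (≤-trans (n≤1+n _) 1+m+K≤c)) (δ-window-above (suc m) K 1+m+K≤c)

  -- A next digit d ≤ b keeps the carry in {0, 1} only if a = q (no carry so far) or a + 1 = q.
  δ-windows-transfer : ∀ {b n} → 2 ≤ b → n < b → ∀ a q →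
    δ-windows (a * b) (suc b) (q * b + n) · X ≡ (δ a q , δ (suc a) q) · carryStep n X
  δ-windows-transfer {b} {n} 2≤b n<b a q with <-cmp a q
  ... | tri≈ _ refl _ = trans (δ-windows-no-carry (a * b) n n<b)
    (sym (trans (cong₂ (λ i j → (i , j) · carryStep n X) (δ-refl a) (δ-≢ (>⇒≢ (n<1+n a)))) ([1,0]· carryStep n X)))
  ... | tri> _ _ q<a = trans (δ-windows-empty (a * b) (suc b) (inj₁ (q<a⇒q*b+n<a*b n<b q<a)))
    (sym (cong₂ (λ i j → (i , j) · carryStep n X) (δ-≢ (>⇒≢ q<a)) (δ-≢ (>⇒≢ (m<n⇒m<1+n q<a)))))
  ... | tri< a<q _ _ with suc a ≟ q
  ...   | yes refl = trans (δ-windows-carry (a * b) n (≤-trans (s≤s z≤n) 2≤b) n<b)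
    (sym (trans (cong₂ (λ i j → (i , j) · carryStep n X) (δ-≢ (<⇒≢ (n<1+n a))) (δ-refl (suc a))) ([0,1]· carryStep n X)))
  ...   | no 1+a≢q = trans (δ-windows-empty (a * b) (suc b) (inj₂ (1+a<q⇒1+a*b+1+b≤q*b+n 2≤b (≤∧≢⇒< a<q 1+a≢q))))
    (sym (cong₂ (λ i j → (i , j) · carryStep n X) (δ-≢ (<⇒≢ a<q)) (δ-≢ 1+a≢q)))

completions : (b a ℓ N : ℕ) → ℕ
completions b a ℓ N = count (λ u → does (readFrom b a u ≟ N)) (words b ℓ)

completions-suc : ∀ b a ℓ N →
  completions b a (suc ℓ) N ≡ sum (applyUpTo (λ d → completions b (a * b + d) ℓ N) (suc b))
completions-suc b a ℓ N =
  trans (count-concatMap-upTo reads-N (λ d → map (d ∷_) (words b ℓ)) (suc b))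
        (sum-applyUpTo-cong (λ d → count-map reads-N (d ∷_) (words b ℓ)) (suc b))
  where
  reads-N : List ℕ → Bool
  reads-N u = does (readFrom b a u ≟ N)

completions-transfer : ∀ {b} → 2 ≤ b → ∀ {ds} → All (_< b) ds → ∀ a q →
  completions b a (length ds) (readFrom b q ds) ≡ (δ a q , δ (suc a) q) · carryCounts ds
completions-transfer 2≤b [] a q = empty-word (δ a q) (δ (suc a) q)
  where
  empty-word : ∀ x y → x + 0 ≡ x * 1 + y * 0
  empty-word = solve-∀
completions-transfer {b} 2≤b {n ∷ ds} (n<b ∷ ds<b) a q = begin
  completions b a (suc (length ds)) (readFrom b Q ds)
    ≡⟨ completions-suc b a (length ds) _ ⟩
  sum (applyUpTo (λ d → completions b (a * b + d) (length ds) (readFrom b Q ds)) (suc b))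
    ≡⟨ sum-applyUpTo-cong (λ d → completions-transfer 2≤b ds<b (a * b + d) Q) (suc b) ⟩
  sum (applyUpTo (λ d → (δ (a * b + d) Q , δ (suc (a * b + d)) Q) · X) (suc b))
    ≡⟨ sum-applyUpTo-linear (λ d → δ (a * b + d) Q) (λ d → δ (suc (a * b + d)) Q) (proj₁ X) (proj₂ X) (suc b) ⟩
  (sum (applyUpTo (λ d → δ (a * b + d) Q) (suc b)) , sum (applyUpTo (λ d → δ (suc (a * b) + d) Q) (suc b))) · X
    ≡⟨ cong₂ (λ i j → (i , j) · X) (sum-δ≡δ-window (a * b) (suc b) Q) (sum-δ≡δ-window (suc (a * b)) (suc b) Q) ⟩
  δ-windows (a * b) (suc b) Q · X
    ≡⟨ δ-windows-transfer X 2≤b n<b a q ⟩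
  (δ a q , δ (suc a) q) · carryStep n X ∎
  where
  open ≡-Reasoning
  Q : ℕ
  Q = q * b + n
  X : ℕ × ℕ
  X = carryCounts ds

carryCounts-zeros : ∀ t n₀ n₁ → foldr carryStep (n₀ , n₁) (replicate t 0) ≡ (n₀ , t * n₀ + n₁)
carryCounts-zeros zero    n₀ n₁ = refl
carryCounts-zeros (suc t) n₀ n₁ =
  trans (cong (carryStep 0) (carryCounts-zeros t n₀ n₁)) (cong (n₀ ,_) (sym (+-assoc n₀ (t * n₀) n₁)))

-- The test by which numOverExpansions filters (private in Defs), restated here.
isOverExpansionᵇ : ℕ → ℕ → List ℕ → Bool
isOverExpansionᵇ b N []          = false
isOverExpansionᵇ b N (zero ∷ _)  = false
isOverExpansionᵇ b N (suc d ∷ u) = does (value b (suc d ∷ u) ≟ N)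

numOverExpansions≡count : ∀ b N →
  numOverExpansions b N ≡ count (isOverExpansionᵇ b N) (concatMap (λ ℓ → words b (suc ℓ)) (upTo N))
numOverExpansions≡count b N = length-filter≡count _ (isOverExpansionᵇ b N)
  (λ { [] → refl ; (zero ∷ _) → refl ; (suc d ∷ u) → does-⌊⌋≟true (value b (suc d ∷ u) ≟ N) })
  (concatMap (λ ℓ → words b (suc ℓ)) (upTo N))
  where
  does-⌊⌋≟true : ∀ {P : Set} (P? : Dec P) → does (⌊ P? ⌋ Bool.≟ true) ≡ does P?
  does-⌊⌋≟true (yes _) = refl
  does-⌊⌋≟true (no _)  = refl

count-isOverExpansion+completions : ∀ b N ℓ →
  count (isOverExpansionᵇ b N) (words b (suc ℓ)) + completions b 0 ℓ N ≡ completions b 0 (suc ℓ) N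
count-isOverExpansion+completions b N ℓ = begin
  count (isOverExpansionᵇ b N) (words b (suc ℓ)) + completions b 0 ℓ N
    ≡⟨ cong (_+ completions b 0 ℓ N) (count-concatMap-upTo _ (λ d → map (d ∷_) (words b ℓ)) (suc b)) ⟩
  count (isOverExpansionᵇ b N) (map (0 ∷_) (words b ℓ))
    + sum (applyUpTo (λ d → count (isOverExpansionᵇ b N) (map (suc d ∷_) (words b ℓ))) b)
    + completions b 0 ℓ N
    ≡⟨ cong (_+ completions b 0 ℓ N) (cong₂ _+_
         (trans (count-map _ (0 ∷_) (words b ℓ)) (count-none _ (λ _ → refl) (words b ℓ)))
         (sum-applyUpTo-cong (λ d → count-map _ (suc d ∷_) (words b ℓ)) b)) ⟩
  sum (applyUpTo (λ d → completions b (suc d) ℓ N) b) + completions b 0 ℓ N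
    ≡⟨ +-comm _ (completions b 0 ℓ N) ⟩
  completions b 0 ℓ N + sum (applyUpTo (λ d → completions b (suc d) ℓ N) b)
    ≡⟨ sym (completions-suc b 0 ℓ N) ⟩
  completions b 0 (suc ℓ) N ∎
  where open ≡-Reasoning

numOverExpansions≡completions : ∀ b N → numOverExpansions b (suc N) ≡ completions b 0 (suc N) (suc N)
numOverExpansions≡completions b N = begin
  numOverExpansions b (suc N)
    ≡⟨ numOverExpansions≡count b (suc N) ⟩
  count (isOverExpansionᵇ b (suc N)) (concatMap (λ ℓ → words b (suc ℓ)) (upTo (suc N)))
    ≡⟨ count-concatMap-upTo _ (λ ℓ → words b (suc ℓ)) (suc N) ⟩
  sum (applyUpTo (λ ℓ → count (isOverExpansionᵇ b (suc N)) (words b (suc ℓ))) (suc N))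
    ≡⟨ sym (+-identityʳ _) ⟩
  sum (applyUpTo (λ ℓ → count (isOverExpansionᵇ b (suc N)) (words b (suc ℓ))) (suc N)) + 0
    ≡⟨ sum-applyUpTo-telescope _ (λ ℓ → completions b 0 ℓ (suc N)) (count-isOverExpansion+completions b (suc N)) (suc N) ⟩
  completions b 0 (suc N) (suc N) ∎
  where open ≡-Reasoning

s≡completions : ∀ b N → 1 ≤ N → s b (N + 1) ≡ completions b 0 N N
s≡completions b (suc N) _ = trans (cong (λ t → s b (suc t)) (+-comm N 1)) (numOverExpansions≡completions b N)

s≡proj₁-carryCounts : ∀ {b} → 2 ≤ b → ∀ {ds} → All (_< b) ds →
  s b (value b (1 ∷ ds) + 1) ≡ proj₁ (carryCounts (1 ∷ ds))
s≡proj₁-carryCounts {b} 2≤b {ds} ds<b = begin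
  s b (N + 1)
    ≡⟨ s≡completions b N (≤-trans (s≤s z≤n) |ws|≤N) ⟩
  completions b 0 N N
    ≡⟨ cong₂ (completions b 0) (sym |padded|≡N) (sym (value-zeros-++ b t ws)) ⟩
  completions b 0 (length padded) (value b padded)
    ≡⟨ completions-transfer 2≤b padded<b 0 0 ⟩
  (1 , 0) · carryCounts padded
    ≡⟨ [1,0]· carryCounts padded ⟩
  proj₁ (carryCounts padded)
    ≡⟨ cong proj₁ (trans (foldr-++ carryStep (1 , 0) (replicate t 0) ws) (carryCounts-zeros t _ _)) ⟩
  proj₁ (carryCounts ws) ∎
  where
  open ≡-Reasoning
  ws padded : List ℕ
  ws = 1 ∷ ds
  N t : ℕ
  N = value b ws
  t = N ∸ length ws
  padded = replicate t 0 ++ ws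
  |ws|≤N : length ws ≤ N
  |ws|≤N = ≤-trans (n<b^n 2≤b (length ds)) (≤-trans (m≤m+n _ (value b ds)) (≤-reflexive (sym (value-1∷zeros++ b 0 ds))))
  |padded|≡N : length padded ≡ N
  |padded|≡N = trans (length-++ (replicate t 0)) (trans (cong (_+ length ws) (length-replicate t)) (m∸n+n≡m |ws|≤N))
  padded<b : All (_< b) padded
  padded<b = ++⁺ (replicate⁺ t (≤-trans (s≤s z≤n) 2≤b)) (2≤b ∷ ds<b)

-- Fibonacci and Lucas numbers

fib : ℕ → ℕ
fib zero          = 0
fib (suc zero)    = 1
fib (suc (suc n)) = fib (suc n) + fib n

blocks : ℕ → List ℕ
blocks m = concat (replicate m (1 ∷ 0 ∷ []))

carryCounts-blocks-fib : ∀ m i → foldr carryStep (fib (suc i) , fib i) (blocks m) ≡ (fib (suc (2 * m + i)) , fib (2 * m + i))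
carryCounts-blocks-fib zero    i = refl
carryCounts-blocks-fib (suc m) i = begin
  carryStep 1 (carryStep 0 (foldr carryStep (fib (suc i) , fib i) (blocks m)))
    ≡⟨ cong (carryStep 1 ∘ carryStep 0) (carryCounts-blocks-fib m i) ⟩
  (fib (suc n) + (fib (suc n) + fib n) , fib (suc n) + fib n)
    ≡⟨ cong (_, fib (suc n) + fib n) (+-comm (fib (suc n)) _) ⟩
  (fib (suc (suc (suc n))) , fib (suc (suc n)))
    ≡⟨ cong (λ t → fib (suc t) , fib t) (sym (cong (_+ i) (*-suc 2 m))) ⟩
  (fib (suc (2 * suc m + i)) , fib (2 * suc m + i)) ∎
  where
  open ≡-Reasoning
  n : ℕ
  n = 2 * m + i

carryCounts-blocks-parity : ∀ m {e} → e < 2 → carryCounts (blocks m ++ replicate e 0) ≡ (fib (suc (2 * m + e)) , fib (2 * m + e))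
carryCounts-blocks-parity m {e} e<2 =
  trans (foldr-++ carryStep (1 , 0) (blocks m) (replicate e 0))
        (trans (cong (λ X → foldr carryStep X (blocks m)) (parity-fib e<2)) (carryCounts-blocks-fib m e))
  where
  parity-fib : ∀ {e} → e < 2 → carryCounts (replicate e 0) ≡ (fib (suc e) , fib e)
  parity-fib {zero}          _ = refl
  parity-fib {suc zero}      _ = refl
  parity-fib {suc (suc _)} (s≤s (s≤s ()))

L-rec : ∀ z → L (z ℤ.+ + 2) ≡ L (z ℤ.+ + 1) ℤ.+ L z
L-rec (+ m) rewrite +-comm m 2 | +-comm m 1 = ℤP.+-comm (proj₁ (lucasPairℕ m)) (proj₂ (lucasPairℕ m))
L-rec -[1+ zero ]          = refl
L-rec -[1+ suc zero ]      = refl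
L-rec -[1+ suc (suc m) ]   = backwards (proj₁ (lucasPairNeg m)) (proj₂ (lucasPairNeg m))
  where
  backwards : ∀ a c → c ℤ.- a ≡ (a ℤ.- (c ℤ.- a)) ℤ.+ ((c ℤ.- a) ℤ.- (a ℤ.- (c ℤ.- a)))
  backwards = ℤSolver.solve-∀

five*pos-+ : ∀ m n → + 5 ℤ.* + (m + n) ≡ + 5 ℤ.* + m ℤ.+ + 5 ℤ.* + n
five*pos-+ m n = trans (cong (+ 5 ℤ.*_) (ℤP.pos-+ m n)) (ℤP.*-distribˡ-+ (+ 5) (+ m) (+ n))

five*fib : ∀ n → + 5 ℤ.* + fib (suc n) ≡ L (+ n) ℤ.+ L (+ suc (suc n))
five*fib zero          = refl
five*fib (suc zero)    = refl
five*fib (suc (suc n)) = begin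
  + 5 ℤ.* + (fib (suc (suc n)) + fib (suc n))
    ≡⟨ five*pos-+ (fib (suc (suc n))) (fib (suc n)) ⟩
  + 5 ℤ.* + fib (suc (suc n)) ℤ.+ + 5 ℤ.* + fib (suc n)
    ≡⟨ cong₂ ℤ._+_ (five*fib (suc n)) (five*fib n) ⟩
  L (+ suc n) ℤ.+ L (+ suc (suc (suc n))) ℤ.+ (L (+ n) ℤ.+ L (+ suc (suc n)))
    ≡⟨ unfolded (L (+ n)) (L (+ suc n)) ⟩
  L (+ suc (suc n)) ℤ.+ L (+ suc (suc (suc (suc n)))) ∎
  where
  open ≡-Reasoning
  unfolded : ∀ a c → c ℤ.+ (c ℤ.+ (a ℤ.+ c)) ℤ.+ (a ℤ.+ (a ℤ.+ c))
                   ≡ (a ℤ.+ c) ℤ.+ ((a ℤ.+ c) ℤ.+ (c ℤ.+ (a ℤ.+ c)))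
  unfolded = ℤSolver.solve-∀

L-rec-down : ∀ v → L v ≡ L (v ℤ.+ + 2) ℤ.- L (v ℤ.+ + 1)
L-rec-down v = trans (isolate (L (v ℤ.+ + 1)) (L v)) (cong (ℤ._- L (v ℤ.+ + 1)) (sym (L-rec v)))
  where
  isolate : ∀ p q → q ≡ (p ℤ.+ q) ℤ.- p
  isolate = ℤSolver.solve-∀

L[v-2+2] : ∀ v → L ((v ℤ.- + 2) ℤ.+ + 2) ≡ L (v ℤ.+ + 2) ℤ.- L (v ℤ.+ + 1)
L[v-2+2] v = trans (cong L (shift v)) (L-rec-down v)
  where
  shift : ∀ v → (v ℤ.- + 2) ℤ.+ + 2 ≡ v
  shift = ℤSolver.solve-∀

L[v-2+1] : ∀ v → L ((v ℤ.- + 2) ℤ.+ + 1) ≡ + 2 ℤ.* L (v ℤ.+ + 1) ℤ.- L (v ℤ.+ + 2)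
L[v-2+1] v = begin
  L (v′ ℤ.+ + 1)
    ≡⟨ L-rec-down (v′ ℤ.+ + 1) ⟩
  L (v′ ℤ.+ + 1 ℤ.+ + 2) ℤ.- L (v′ ℤ.+ + 1 ℤ.+ + 1)
    ≡⟨ cong₂ (λ i j → L i ℤ.- L j) (shift₁ v) (shift₀ v) ⟩
  L (v ℤ.+ + 1) ℤ.- L v
    ≡⟨ cong (λ t → L (v ℤ.+ + 1) ℤ.- t) (L-rec-down v) ⟩
  L (v ℤ.+ + 1) ℤ.- (L (v ℤ.+ + 2) ℤ.- L (v ℤ.+ + 1))
    ≡⟨ regroup (L (v ℤ.+ + 1)) (L (v ℤ.+ + 2)) ⟩
  + 2 ℤ.* L (v ℤ.+ + 1) ℤ.- L (v ℤ.+ + 2) ∎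
  where
  open ≡-Reasoning
  v′ : ℤ
  v′ = v ℤ.- + 2
  shift₁ : ∀ v → v ℤ.- + 2 ℤ.+ + 1 ℤ.+ + 2 ≡ v ℤ.+ + 1
  shift₁ = ℤSolver.solve-∀
  shift₀ : ∀ v → v ℤ.- + 2 ℤ.+ + 1 ℤ.+ + 1 ≡ v
  shift₀ = ℤSolver.solve-∀
  regroup : ∀ p q → p ℤ.- (q ℤ.- p) ≡ + 2 ℤ.* p ℤ.- q
  regroup = ℤSolver.solve-∀

-- At a natural index L unfolds definitionally (L (+ suc (suc n)) = L (+ n) + L (+ suc n)),
-- so only the falling index v needs L-rec. At the end u = r and v = r - 4x, which may be
-- negative.
record LucasCounts (X : ℕ × ℕ) (u : ℕ) (v : ℤ) : Set where
  constructor _,_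
  field
    no-carry : + 5 ℤ.* + proj₁ X ≡ + 2 ℤ.* L (+ suc (suc u)) ℤ.- L (v ℤ.+ + 1)
    carry    : + 5 ℤ.* + proj₂ X ≡ + 2 ℤ.* L (+ suc u) ℤ.+ L (v ℤ.+ + 2)

LucasCounts-fib : ∀ R → LucasCounts (fib (suc R) , fib (suc (suc R))) R (+ R)
LucasCounts-fib R = 
    trans (five*fib R)
      (trans (unfold₀ (L (+ R)) (L (+ suc R))) (cong (λ t → + 2 ℤ.* L (+ suc (suc R)) ℤ.- L t) (index-+1 R)))
  , trans (five*fib (suc R))
      (trans (unfold₁ (L (+ R)) (L (+ suc R))) (cong (λ t → + 2 ℤ.* L (+ suc R) ℤ.+ L t) (index-+2 R)))
  where
  index-+1 : ∀ R → + suc R ≡ + R ℤ.+ + 1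
  index-+1 R = cong +_ (+-comm 1 R)
  index-+2 : ∀ R → + suc (suc R) ≡ + R ℤ.+ + 2
  index-+2 R = cong +_ (+-comm 2 R)
  unfold₀ : ∀ a c → a ℤ.+ (a ℤ.+ c) ≡ + 2 ℤ.* (a ℤ.+ c) ℤ.- c
  unfold₀ = ℤSolver.solve-∀
  unfold₁ : ∀ a c → c ℤ.+ (c ℤ.+ (a ℤ.+ c)) ≡ + 2 ℤ.* c ℤ.+ (a ℤ.+ c)
  unfold₁ = ℤSolver.solve-∀

LucasCounts-block : ∀ {X u v} → LucasCounts X u v →
  LucasCounts (carryStep 1 (carryStep 0 X)) (suc (suc u)) (v ℤ.- + 2)
LucasCounts-block {n₀ , n₁} {u} {v} (h₀ , h₁) =
  (begin
    + 5 ℤ.* + (n₀ + (n₀ + n₁))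
      ≡⟨ trans (five*pos-+ n₀ (n₀ + n₁)) (cong (ℤ._+_ (+ 5 ℤ.* + n₀)) (five*pos-+ n₀ n₁)) ⟩
    + 5 ℤ.* + n₀ ℤ.+ (+ 5 ℤ.* + n₀ ℤ.+ + 5 ℤ.* + n₁)
      ≡⟨ cong₂ (λ i j → i ℤ.+ (i ℤ.+ j)) h₀ h₁ ⟩
    X₀ ℤ.+ (X₀ ℤ.+ (+ 2 ℤ.* a ℤ.+ q))
      ≡⟨ regroup₀ a c p q ⟩
    + 2 ℤ.* (c ℤ.+ (a ℤ.+ c)) ℤ.- (+ 2 ℤ.* p ℤ.- q)
      ≡⟨ cong (λ t → + 2 ℤ.* L (+ suc (suc (suc (suc u)))) ℤ.- t) (sym (L[v-2+1] v)) ⟩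
    + 2 ℤ.* L (+ suc (suc (suc (suc u)))) ℤ.- L ((v ℤ.- + 2) ℤ.+ + 1) ∎)
  ,
  (begin
    + 5 ℤ.* + (n₀ + n₁)
      ≡⟨ five*pos-+ n₀ n₁ ⟩
    + 5 ℤ.* + n₀ ℤ.+ + 5 ℤ.* + n₁
      ≡⟨ cong₂ ℤ._+_ h₀ h₁ ⟩
    X₀ ℤ.+ (+ 2 ℤ.* a ℤ.+ q)
      ≡⟨ regroup₁ a c p q ⟩
    + 2 ℤ.* (a ℤ.+ c) ℤ.+ (q ℤ.- p)
      ≡⟨ cong (λ t → + 2 ℤ.* L (+ suc (suc (suc u))) ℤ.+ t) (sym (L[v-2+2] v)) ⟩
    + 2 ℤ.* L (+ suc (suc (suc u))) ℤ.+ L ((v ℤ.- + 2) ℤ.+ + 2) ∎)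
  where
  open ≡-Reasoning
  a c p q X₀ : ℤ
  a = L (+ suc u)
  c = L (+ suc (suc u))
  p = L (v ℤ.+ + 1)
  q = L (v ℤ.+ + 2)
  X₀ = + 2 ℤ.* c ℤ.- p
  regroup₀ : ∀ a c p q → (+ 2 ℤ.* c ℤ.- p) ℤ.+ ((+ 2 ℤ.* c ℤ.- p) ℤ.+ (+ 2 ℤ.* a ℤ.+ q))
                       ≡ + 2 ℤ.* (c ℤ.+ (a ℤ.+ c)) ℤ.- (+ 2 ℤ.* p ℤ.- q)
  regroup₀ = ℤSolver.solve-∀
  regroup₁ : ∀ a c p q → (+ 2 ℤ.* c ℤ.- p) ℤ.+ (+ 2 ℤ.* a ℤ.+ q) ≡ + 2 ℤ.* (a ℤ.+ c) ℤ.+ (q ℤ.- p)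
  regroup₁ = ℤSolver.solve-∀

LucasCounts-blocks : ∀ x {X u v} → LucasCounts X u v →
  LucasCounts (foldr carryStep X (blocks x)) (2 * x + u) (v ℤ.- + 2 ℤ.* + x)
LucasCounts-blocks zero {X} {u} {v} h = subst (LucasCounts X u) (sym (ℤP.+-identityʳ v)) h
LucasCounts-blocks (suc x) {X} {u} {v} h =
  subst₂ (LucasCounts (carryStep 1 (carryStep 0 (foldr carryStep X (blocks x)))))
         (sym (cong (_+ u) (*-suc 2 x))) (step-down v (+ x))
         (LucasCounts-block {u = 2 * x + u} (LucasCounts-blocks x h))
  where
  step-down : ∀ v t → v ℤ.- + 2 ℤ.* t ℤ.- + 2 ≡ v ℤ.- + 2 ℤ.* (+ 1 ℤ.+ t)
  step-down = ℤSolver.solve-∀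

lucasCombination : ℤ → ℤ → ℤ → ℤ → ℤ
lucasCombination K u₂ u₁ v = K ℤ.* (+ 2 ℤ.* L u₂ ℤ.- L (v ℤ.+ + 1)) ℤ.+ + 2 ℤ.* L u₁ ℤ.+ L (v ℤ.+ + 2)

LucasCounts⇒five*count : ∀ j {X u v} → LucasCounts X u v →
  + 5 ℤ.* + (proj₁ X + (j * proj₁ X + proj₂ X)) ≡ lucasCombination (+ suc j) (+ suc (suc u)) (+ suc u) v
LucasCounts⇒five*count j {n₀ , n₁} {u} {v} (h₀ , h₁) = begin
  + 5 ℤ.* + (n₀ + (j * n₀ + n₁))
    ≡⟨ cong (+ 5 ℤ.*_) total≡ ⟩
  + 5 ℤ.* (+ suc j ℤ.* + n₀ ℤ.+ + n₁)
    ≡⟨ distribute (+ suc j) (+ n₀) (+ n₁) ⟩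
  + suc j ℤ.* (+ 5 ℤ.* + n₀) ℤ.+ + 5 ℤ.* + n₁
    ≡⟨ cong₂ (λ a c → + suc j ℤ.* a ℤ.+ c) h₀ h₁ ⟩
  + suc j ℤ.* X₀ ℤ.+ (+ 2 ℤ.* L (+ suc u) ℤ.+ L (v ℤ.+ + 2))
    ≡⟨ ℤP.+-assoc (+ suc j ℤ.* X₀) _ _ ⟨
  lucasCombination (+ suc j) (+ suc (suc u)) (+ suc u) v ∎
  where
  open ≡-Reasoning
  X₀ : ℤ
  X₀ = + 2 ℤ.* L (+ suc (suc u)) ℤ.- L (v ℤ.+ + 1)
  total≡ : + (n₀ + (j * n₀ + n₁)) ≡ + suc j ℤ.* + n₀ ℤ.+ + n₁
  total≡ = trans (cong +_ (sym (+-assoc n₀ (j * n₀) n₁)))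
                 (trans (ℤP.pos-+ (suc j * n₀) n₁) (cong (ℤ._+ + n₁) (ℤP.pos-* (suc j) n₀)))
  distribute : ∀ J a c → + 5 ℤ.* (J ℤ.* a ℤ.+ c) ≡ J ℤ.* (+ 5 ℤ.* a) ℤ.+ + 5 ℤ.* c
  distribute = ℤSolver.solve-∀

-- The word w(k,r,x)

sumPow-peel : ∀ b r x → sumPow b (2 + r) (suc x) ≡ b ^ (2 + r) + sumPow b r x
sumPow-peel b r zero    = refl
sumPow-peel b r (suc x) = begin
  sumPow b (2 + r) (suc x) + b ^ (2 + r ∸ 2 * suc (suc x))
    ≡⟨ cong (_+ b ^ (2 + r ∸ 2 * suc (suc x))) (sumPow-peel b r x) ⟩
  b ^ (2 + r) + sumPow b r x + b ^ (2 + r ∸ 2 * suc (suc x))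
    ≡⟨ +-assoc (b ^ (2 + r)) (sumPow b r x) _ ⟩
  b ^ (2 + r) + (sumPow b r x + b ^ (2 + r ∸ 2 * suc (suc x)))
    ≡⟨ cong (λ t → b ^ (2 + r) + (sumPow b r x + b ^ (2 + r ∸ t))) (*-suc 2 (suc x)) ⟩
  b ^ (2 + r) + (sumPow b r x + b ^ (r ∸ 2 * suc x)) ∎
  where open ≡-Reasoning

sumPow-mono : ∀ b r {x y} → x ≤ y → sumPow b r x ≤ sumPow b r y
sumPow-mono b r {x} {y} x≤y with m≤n⇒∃[o]m+o≡n x≤y
... | t , refl = grow t
  where
  grow : ∀ t → sumPow b r x ≤ sumPow b r (x + t)
  grow zero    = ≤-reflexive (cong (sumPow b r) (sym (+-identityʳ x)))
  grow (suc t) = ≤-trans (grow t) (≤-trans (m≤m+n _ _) (≤-reflexive (cong (sumPow b r) (sym (+-suc x t)))))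

length-blocks : ∀ m → length (blocks m) ≡ 2 * m
length-blocks zero    = refl
length-blocks (suc m) = trans (cong (suc ∘ suc) (length-blocks m)) (sym (*-suc 2 m))

blocks-digits : ∀ {b} → 2 ≤ b → ∀ m → All (_< b) (blocks m)
blocks-digits 2≤b m = concat⁺ (replicate⁺ m (2≤b ∷ ≤-trans (s≤s z≤n) 2≤b ∷ []))

value-blocks-++<sumPow : ∀ b x {R u} → length u ≡ suc R → value b u < b ^ R → value b (blocks x ++ u) < sumPow b (2 * x + R) x
value-blocks-++<sumPow b zero    |u|≡1+R u<b^R = u<b^R
value-blocks-++<sumPow b (suc x) {R} {u} |u|≡1+R u<b^R = begin-strict
  value b (1 ∷ rest)                              ≡⟨ value-∷ b 1 rest ⟩
  1 * b ^ length rest + value b rest              ≡⟨ cong (_+ value b rest) (*-identityˡ (b ^ length rest)) ⟩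
  b ^ length rest + value b rest                  <⟨ +-monoʳ-< (b ^ length rest) (value-blocks-++<sumPow b x |u|≡1+R u<b^R) ⟩
  b ^ length rest + sumPow b (2 * x + R) x        ≡⟨ cong (λ t → b ^ t + sumPow b (2 * x + R) x) |rest| ⟩
  b ^ (2 + (2 * x + R)) + sumPow b (2 * x + R) x  ≡⟨ sym (sumPow-peel b (2 * x + R) x) ⟩
  sumPow b (2 + (2 * x + R)) (suc x)              ≡⟨ cong (λ t → sumPow b (t + R) (suc x)) (sym (*-suc 2 x)) ⟩
  sumPow b (2 * suc x + R) (suc x)                ∎
  where
  open ≤-Reasoning
  rest : List ℕ
  rest = 0 ∷ blocks x ++ u
  |rest| : length rest ≡ 2 + (2 * x + R)
  |rest| = cong suc (trans (length-++ (blocks x)) (trans (cong₂ _+_ (length-blocks x) |u|≡1+R) (+-suc (2 * x) R)))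

suffix : ℕ → ℕ → ℕ → List ℕ
suffix x m e = blocks x ++ 0 ∷ blocks m ++ replicate e 0

w≡1∷zeros++suffix : ∀ k r x → w k r x ≡ 1 ∷ replicate (k ∸ r ∸ 1) 0 ++ suffix x (r / 2 ∸ x) (r % 2)
w≡1∷zeros++suffix k r x =
  cong (λ tail → 1 ∷ replicate (k ∸ r ∸ 1) 0 ++ blocks x ++ 0 ∷ blocks (r / 2 ∸ x) ++ tail) (parity-tail (m%n<n r 2))
  where
  parity-tail : ∀ {e} → e < 2 → (if ⌊ e ≟ 1 ⌋ then 0 ∷ [] else []) ≡ replicate e 0
  parity-tail {zero}        _ = refl
  parity-tail {suc zero}    _ = refl
  parity-tail {suc (suc _)} (s≤s (s≤s ()))

length-blocks-++-zeros : ∀ m e → length (blocks m ++ replicate e 0) ≡ 2 * m + e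
length-blocks-++-zeros m e = trans (length-++ (blocks m)) (cong₂ _+_ (length-blocks m) (length-replicate e))

blocks-++-zeros-digits : ∀ {b} → 2 ≤ b → ∀ m e → All (_< b) (blocks m ++ replicate e 0)
blocks-++-zeros-digits 2≤b m e = ++⁺ (blocks-digits 2≤b m) (replicate⁺ e (≤-trans (s≤s z≤n) 2≤b))

length-suffix : ∀ x m e → length (suffix x m e) ≡ suc (2 * x + (2 * m + e))
length-suffix x m e = begin
  length (blocks x ++ 0 ∷ blocks m ++ replicate e 0)
    ≡⟨ length-++ (blocks x) ⟩
  length (blocks x) + suc (length (blocks m ++ replicate e 0))
    ≡⟨ cong₂ (λ i j → i + suc j) (length-blocks x) (length-blocks-++-zeros m e) ⟩
  2 * x + suc (2 * m + e)
    ≡⟨ +-suc (2 * x) (2 * m + e) ⟩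
  suc (2 * x + (2 * m + e)) ∎
  where open ≡-Reasoning

suffix-digits : ∀ {b} → 2 ≤ b → ∀ x m e → All (_< b) (suffix x m e)
suffix-digits 2≤b x m e = ++⁺ (blocks-digits 2≤b x) (≤-trans (s≤s z≤n) 2≤b ∷ blocks-++-zeros-digits 2≤b m e)

value-suffix<sumPow : ∀ {b} → 2 ≤ b → ∀ x m e → value b (suffix x m e) < sumPow b (2 * x + (2 * m + e)) x
value-suffix<sumPow {b} 2≤b x m e =
  value-blocks-++<sumPow b x (cong suc (length-blocks-++-zeros m e))
    (subst (λ n → value b (blocks m ++ replicate e 0) < b ^ n) (length-blocks-++-zeros m e)
           (value<b^length b (blocks-++-zeros-digits 2≤b m e)))

LucasCounts-suffix : ∀ x m {e} → e < 2 →
  LucasCounts (carryCounts (suffix x m e)) (2 * x + (2 * m + e)) (+ (2 * m + e) ℤ.- + 2 ℤ.* + x)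
LucasCounts-suffix x m {e} e<2 =
  subst (λ X → LucasCounts X (2 * x + R) (+ R ℤ.- + 2 ℤ.* + x))
        (sym (foldr-++ carryStep (1 , 0) (blocks x) (0 ∷ blocks m ++ replicate e 0)))
        (LucasCounts-blocks x (subst (λ X → LucasCounts (carryStep 0 X) R (+ R))
                                     (sym (carryCounts-blocks-parity m e<2)) (LucasCounts-fib R)))
  where
  R : ℕ
  R = 2 * m + e

s-1∷zeros++ : ∀ {b} → 2 ≤ b → ∀ j {u} → All (_< b) u →
  s b (value b (1 ∷ replicate j 0 ++ u) + 1) ≡ proj₁ (carryCounts u) + (j * proj₁ (carryCounts u) + proj₂ (carryCounts u))
s-1∷zeros++ 2≤b j {u} u<b =
  trans (s≡proj₁-carryCounts 2≤b (++⁺ (replicate⁺ j (≤-trans (s≤s z≤n) 2≤b)) u<b))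
        (cong (proj₁ ∘ carryStep 1) (trans (foldr-++ carryStep (1 , 0) (replicate j 0) u) (carryCounts-zeros j _ _)))

lucasCombination≡fiveV : ∀ k r x j → suc j + r ≡ k →
  lucasCombination (+ suc j) (+ suc (suc r)) (+ suc r) (+ r ℤ.- + (4 * x)) ≡ fiveV k r x
lucasCombination≡fiveV k r x j refl =
  trans (cong₂ (λ K u₂ → lucasCombination K u₂ (+ suc r) v) (sym (cancel (+ suc j) (+ r))) (cong +_ (+-comm 2 r)))
        (cong (λ u₁ → lucasCombination (+ (suc j + r) ℤ.- + r) (+ r ℤ.+ + 2) u₁ v) (cong +_ (+-comm 1 r)))
  where
  v : ℤ
  v = + r ℤ.- + (4 * x)
  cancel : ∀ a c → a ℤ.+ c ℤ.- c ≡ a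
  cancel = ℤSolver.solve-∀

+R-2x≡+[2x+R]-4x : ∀ x R → + R ℤ.- + 2 ℤ.* + x ≡ + (2 * x + R) ℤ.- + (4 * x)
+R-2x≡+[2x+R]-4x x R = begin
  + R ℤ.- + 2 ℤ.* + x                       ≡⟨ regroup (+ R) (+ x) ⟩
  + 2 ℤ.* + x ℤ.+ + R ℤ.- + 4 ℤ.* + x       ≡⟨ cong₂ (λ a c → a ℤ.+ + R ℤ.- c) (ℤP.pos-* 2 x) (ℤP.pos-* 4 x) ⟨
  + (2 * x) ℤ.+ + R ℤ.- + (4 * x)           ≡⟨ cong (ℤ._- + (4 * x)) (ℤP.pos-+ (2 * x) R) ⟨
  + (2 * x + R) ℤ.- + (4 * x)               ∎
  where
  open ≡-Reasoning
  regroup : ∀ R t → R ℤ.- + 2 ℤ.* t ≡ + 2 ℤ.* t ℤ.+ R ℤ.- + 4 ℤ.* t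
  regroup = ℤSolver.solve-∀

r≡2x+[2m+e] : ∀ r x → 2 * x < r → r ≡ 2 * x + (2 * (r / 2 ∸ x) + r % 2)
r≡2x+[2m+e] r x 2x<r = begin
  r                                 ≡⟨ m≡m%n+[m/n]*n r 2 ⟩
  r % 2 + r / 2 * 2                 ≡⟨ cong (λ h → r % 2 + h * 2) (sym (m∸n+n≡m x≤r/2)) ⟩
  r % 2 + (r / 2 ∸ x + x) * 2       ≡⟨ regroup (r % 2) (r / 2 ∸ x) x ⟩
  2 * x + (2 * (r / 2 ∸ x) + r % 2) ∎
  where
  open ≡-Reasoning
  x≤r/2 : x ≤ r / 2
  x≤r/2 = subst (_≤ r / 2) (m*n/n≡m x 2) (/-monoˡ-≤ 2 (≤-trans (≤-reflexive (*-comm x 2)) (<⇒≤ 2x<r)))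
  regroup : ∀ e m x → e + (m + x) * 2 ≡ 2 * x + (2 * m + e)
  regroup = solve-∀

1+[k∸r∸1]+r≡k : ∀ k r → r + 1 < k → suc (k ∸ r ∸ 1) + r ≡ k
1+[k∸r∸1]+r≡k k r r+1<k = begin
  suc (k ∸ r ∸ 1 + r)       ≡⟨ sym (+-suc (k ∸ r ∸ 1) r) ⟩
  k ∸ r ∸ 1 + suc r         ≡⟨ cong₂ _+_ (∸-+-assoc k r 1) (+-comm 1 r) ⟩
  k ∸ (r + 1) + (r + 1)     ≡⟨ m∸n+n≡m (<⇒≤ r+1<k) ⟩
  k                         ∎
  where open ≡-Reasoning

γ≡b^k+value-suffix : ∀ b k r x → 2 * x < r → r + 1 < k →
  γ b k r x ≡ b ^ k + value b (suffix x (r / 2 ∸ x) (r % 2))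
γ≡b^k+value-suffix b k r x 2x<r r+1<k = begin
  γ b k r x                              ≡⟨ cong (value b) (w≡1∷zeros++suffix k r x) ⟩
  value b (1 ∷ replicate j 0 ++ suf)     ≡⟨ value-1∷zeros++ b j suf ⟩
  b ^ (j + length suf) + value b suf     ≡⟨ cong (λ t → b ^ (j + t) + value b suf) |suf|≡1+r ⟩
  b ^ (j + suc r) + value b suf          ≡⟨ cong (λ t → b ^ t + value b suf) (trans (+-suc j r) (1+[k∸r∸1]+r≡k k r r+1<k)) ⟩
  b ^ k + value b suf                    ∎
  where
  open ≡-Reasoning
  j : ℕ
  j = k ∸ r ∸ 1
  suf : List ℕ
  suf = suffix x (r / 2 ∸ x) (r % 2)
  |suf|≡1+r : length suf ≡ suc r
  |suf|≡1+r = trans (length-suffix x (r / 2 ∸ x) (r % 2)) (cong suc (sym (r≡2x+[2m+e] r x 2x<r)))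

γ+1∈I : ∀ b k r x y → 2 ≤ b → 2 * x ≤ 2 * y → 2 * y < r → r + 1 < k → InI b k r y (γ b k r x + 1)
γ+1∈I b k r x y 2≤b 2x≤2y 2y<r r+1<k =
  ≤-<-trans (≤-trans (m≤m+n (b ^ k) _) (≤-reflexive (sym γ≡))) (m<m+n (γ b k r x) z<s) , (begin
    γ b k r x + 1                 ≡⟨ trans (cong (_+ 1) γ≡) (+-assoc (b ^ k) _ 1) ⟩
    b ^ k + (value b suf + 1)     ≡⟨ cong (_+_ (b ^ k)) (+-comm _ 1) ⟩
    b ^ k + suc (value b suf)     ≤⟨ +-monoʳ-≤ (b ^ k) suf<sumPow ⟩
    b ^ k + sumPow b r x          ≤⟨ +-monoʳ-≤ (b ^ k) (sumPow-mono b r {x} {y} (*-cancelˡ-≤ 2 2x≤2y)) ⟩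
    b ^ k + sumPow b r y          ∎)
  where
  open ≤-Reasoning
  2x<r : 2 * x < r
  2x<r = ≤-<-trans 2x≤2y 2y<r
  suf : List ℕ
  suf = suffix x (r / 2 ∸ x) (r % 2)
  γ≡ : γ b k r x ≡ b ^ k + value b suf
  γ≡ = γ≡b^k+value-suffix b k r x 2x<r r+1<k
  suf<sumPow : value b suf < sumPow b r x
  suf<sumPow = subst (λ t → value b suf < sumPow b t x) (sym (r≡2x+[2m+e] r x 2x<r))
                     (value-suffix<sumPow 2≤b x (r / 2 ∸ x) (r % 2))

five*s≡fiveV : ∀ b k r x → 2 ≤ b → 2 * x < r → r + 1 < k → + 5 ℤ.* + s b (γ b k r x + 1) ≡ fiveV k r x
five*s≡fiveV b k r x 2≤b 2x<r r+1<k = begin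
  + 5 ℤ.* + s b (γ b k r x + 1)
    ≡⟨ cong (λ t → + 5 ℤ.* + s b (value b t + 1)) (w≡1∷zeros++suffix k r x) ⟩
  + 5 ℤ.* + s b (value b (1 ∷ replicate j 0 ++ suf) + 1)
    ≡⟨ cong (λ t → + 5 ℤ.* + t) (s-1∷zeros++ 2≤b j (suffix-digits 2≤b x m e)) ⟩
  + 5 ℤ.* + (proj₁ (carryCounts suf) + (j * proj₁ (carryCounts suf) + proj₂ (carryCounts suf)))
    ≡⟨ LucasCounts⇒five*count j lucas ⟩
  lucasCombination (+ suc j) (+ suc (suc r)) (+ suc r) (+ r ℤ.- + (4 * x))
    ≡⟨ lucasCombination≡fiveV k r x j (1+[k∸r∸1]+r≡k k r r+1<k) ⟩
  fiveV k r x ∎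
  where
  open ≡-Reasoning
  m e j : ℕ
  m = r / 2 ∸ x
  e = r % 2
  j = k ∸ r ∸ 1
  suf : List ℕ
  suf = suffix x m e
  r≡ : r ≡ 2 * x + (2 * m + e)
  r≡ = r≡2x+[2m+e] r x 2x<r
  lucas : LucasCounts (carryCounts suf) r (+ r ℤ.- + (4 * x))
  lucas = subst₂ (LucasCounts (carryCounts suf)) (sym r≡)
                 (trans (+R-2x≡+[2x+R]-4x x (2 * m + e)) (cong (λ t → + t ℤ.- + (4 * x)) (sym r≡)))
                 (LucasCounts-suffix x m (m%n<n r 2))

lemma21 : (b k r x y : ℕ) → 2 ≤ b → 2 * x ≤ 2 * y → 2 * y < r → r + 1 < k →
    InI b k r y (γ b k r x + 1)
    × (Data.Integer._*_ (+ 5) (+ s b (γ b k r x + 1)) ≡ fiveV k r x)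
lemma21 b k r x y 2≤b 2x≤2y 2y<r r+1<k =
  γ+1∈I b k r x y 2≤b 2x≤2y 2y<r r+1<k , five*s≡fiveV b k r x 2≤b (≤-<-trans 2x≤2y 2y<r) r+1<k
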